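{- Let $(S,x)$ be a locally optimal solution of UnifFLPP and let $(S^*,x^*)$ be an optimum solution. Then $$c_s(S)+c_p(S)\le c_s(S^*)+c_p(S^*)+c_f(S^*)=c(S^*).$$
   Context: UnifFLPP: finite facility set $F$, finite client set $C$, metric distances $c_{ij}\ge0$ on $F\cup C$; facility $i$ has opening cost $f_i\ge0$ and capacity $U$ (the same for all facilities); client $j$ has demand $d_j\ge0$ and penalty $p_j\ge0$ per unit of unserved demand. A solution is a set $S\subseteq F$ with an assignment $x(i,j)\ge0$ ($i\in S,j\in C$) satisfying $\sum_j x(i,j)\le U$ for $i\in S$ and $\sum_{i\in S}x(i,j)\le d_j$ for $j\in C$. Costs: $c_f(S)=\sum_{i\in S}f_i$, $c_s(S)=\sum_{i,j}c_{ij}x(i,j)$, $c_p(S)=\sum_j p_j(d_j-\sum_{i\in S}x(i,j))$, $c(S)=c_f(S)+c_s(S)+c_p(S)$. For a set $S$, the cost of $S$ is the minimum cost over all feasible assignments for $S$. The local search operations are $\mathrm{add}(t)$: $S\gets S\cup\{t\}$ for $t\notin S$; $\mathrm{delete}(s)$: $S\gets S\setminus\{s\}$ for $s\in S$; $\mathrm{swap}(s,t)$: $S\gets S\cup\{t\}\setminus\{s\}$ for $s\in S,t\notin S$. A solution $(S,x)$ is locally optimal if $x$ is a minimum-cost assignment for $S$ and none of these operations produces a set whose cost is strictly smaller than $c(S)$.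
   Formalization: The distances, opening costs $f_i$, capacity $U$, demands $d_j$, penalties $p_j$ and all assignments, including those compared against in local optimality and optimality, take values in ℚ. -}

module Defs where

open import Data.Nat using (ℕ; zero; suc)
open import Data.Fin using (Fin; zero; suc)
open import Data.Fin.Subset using (Subset; _∈_; _∉_; _∪_; ⁅_⁆) renaming (_-_ to _⊖_)
open import Data.Sum using (_⊎_; inj₁; inj₂)
open import Data.Product using (_×_; Σ)
open import Data.Rational using (ℚ; 0ℚ; _+_; _*_; _-_; _≤_; _<_)
open import Relation.Binary.PropositionalEquality using (_≡_)

sumFin : (k : ℕ) → (Fin k → ℚ) → ℚ
sumFin zero    g = 0ℚ
sumFin (suc k) g = g zero + sumFin k (λ i → g (suc i))

-- An instance of UnifFLPP with facilities F = Fin m and clients C = Fin n.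
record Instance (m n : ℕ) : Set where
  field
    -- distances on F ∪ C (inj₁ = facility, inj₂ = client)
    dist    : Fin m ⊎ Fin n → Fin m ⊎ Fin n → ℚ
    dist-nonneg : ∀ a b → 0ℚ ≤ dist a b
    dist-refl   : ∀ a → dist a a ≡ 0ℚ
    dist-sym    : ∀ a b → dist a b ≡ dist b a
    dist-tri    : ∀ a b e → dist a e ≤ dist a b + dist b e
    f       : Fin m → ℚ      -- opening costs
    f-nonneg : ∀ i → 0ℚ ≤ f i
    U       : ℚ              -- uniform capacity
    d       : Fin n → ℚ      -- demands
    d-nonneg : ∀ j → 0ℚ ≤ d j
    p       : Fin n → ℚ      -- per-unit penalties
    p-nonneg : ∀ j → 0ℚ ≤ p j

  c : Fin m → Fin n → ℚ
  c i j = dist (inj₁ i) (inj₂ j)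

module _ {m n : ℕ} (I : Instance m n) where
  open Instance I

  -- An assignment is x : F → C → ℚ; x(i,j) is only meaningful for i ∈ S,
  -- so it is required to vanish for i ∉ S.
  Assignment : Set
  Assignment = Fin m → Fin n → ℚ

  record Feasible (S : Subset m) (x : Assignment) : Set where
    field
      nonneg   : ∀ i j → 0ℚ ≤ x i j
      outside  : ∀ i j → i ∉ S → x i j ≡ 0ℚ
      capacity : ∀ i → i ∈ S → sumFin n (λ j → x i j) ≤ U
      demand   : ∀ j → sumFin m (λ i → x i j) ≤ d j

  open import Data.Bool using (Bool; true; false)
  open import Data.Vec using (lookup)

  fIf : Bool → ℚ → ℚ
  fIf true  a = a
  fIf false a = 0ℚ

  cf : Subset m → ℚ
  cf S = sumFin m (λ i → fIf (lookup S i) (f i))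

  cs : Assignment → ℚ
  cs x = sumFin m (λ i → sumFin n (λ j → c i j * x i j))

  cp : Assignment → ℚ
  cp x = sumFin n (λ j → p j * (d j - sumFin m (λ i → x i j)))

  cost : Subset m → Assignment → ℚ
  cost S x = cf S + cs x + cp x

  data LocalMove (S : Subset m) : Subset m → Set where
    add    : ∀ t → t ∉ S → LocalMove S (S ∪ ⁅ t ⁆)
    delete : ∀ s → s ∈ S → LocalMove S (S ⊖ s)
    swap   : ∀ s t → s ∈ S → t ∉ S → LocalMove S ((S ∪ ⁅ t ⁆) ⊖ s)

  record LocallyOptimal (S : Subset m) (x : Assignment) : Set where
    field
      feasible : Feasible S x
      minAssign : ∀ y → Feasible S y → cost S x ≤ cost S y
      noImprove : ∀ T → LocalMove S T → ∀ y → Feasible T y → cost S x ≤ cost T y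

  record Optimal (S : Subset m) (x : Assignment) : Set where
    field
      feasible : Feasible S x
      optimal  : ∀ T y → Feasible T y → cost S x ≤ cost T y

{-# OPTIONS --safe #-}
-- Write L w = cs w + cp w. It is affine in w, so y + z′ = x + z implies L y + L z′ = L x + L z.
-- Let z be feasible for a facility set P ⊇ S whose facilities outside S lie in S* (initially z = x*),
-- and let t ∈ P ∖ S. Viewed as a flow on the bipartite facility–client graph, z − x splits into a
-- conformal part carrying the whole row of t and supported on S ∪ {t}, plus a remainder; the part is
-- extracted by pushing flow out of t along augmenting paths. Adding the part to x gives y, feasible for
-- S ∪ {t}, and z′ = x + z − y is feasible for P ∖ {t}: every entry, row sum and column sum of y and z′
-- lies between those of x and z. The move add(t) gives L x ≤ L y + f t, induction gives
-- L x ≤ L z′ + (opening costs of P ∖ S ∖ {t}), and adding both yields L x ≤ L z + (opening costs of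
-- P ∖ S). Whether a node is reachable is not decided, so the path search runs in the double-negation
-- monad; this is harmless because the conclusion, an inequality between rationals, is decidable.

module Submission where

open import Defs

open import Level using (0ℓ)
open import Algebra.Bundles using (CommutativeMonoid; CommutativeRing)
open import Data.Bool using (true; false; if_then_else_; _∨_)
open import Data.Empty using (⊥-elim)
open import Data.Fin using (Fin; zero; suc)
open import Data.Fin.Properties using () renaming (_≟_ to _≟ᶠ_)
open import Data.Fin.Subset using (Subset; _∈_; _∉_; _∪_; ⁅_⁆; inside; outside) renaming (_-_ to _⊖_)
open import Data.Fin.Subset.Properties
  using (_∈?_; p⊆p∪q; x∈p∪q⁺; x∈p∪q⁻; x∈⁅x⁆; x∈⁅y⁆⇒x≡y; x∈p∧x≢y⇒x∈p-y; p─q⊆p)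
open import Data.Vec using (_∷_; lookup; there)
open import Data.Vec.Properties using (lookup-zipWith; lookup-replicate; []=⇒lookup)
open import Data.Sum.Properties using (≡-dec)
open import Data.Unit using (⊤; tt)
open import Data.Nat as ℕ using (ℕ; zero; suc)
import Data.Nat.Properties as ℕ
open import Data.Product using (Σ; Σ-syntax; _×_; _,_)
open import Data.Rational using (ℚ; 0ℚ; 1ℚ; _+_; _*_; _-_; -_; _≤_; _<_; _⊓_; _≤?_; _≟_)
open import Data.Rational.Properties
open import Data.Sum using (_⊎_; inj₁; inj₂)
open import Function using (_∘_)
open import Relation.Binary.PropositionalEquality
open import Relation.Nullary using (¬_; ¬?; Dec; yes; no; does)
open import Relation.Nullary.Decidable
  using (dec⇒maybe; _⊎-dec_; _×-dec_; ¬¬-excluded-middle; decidable-stable)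
open import Relation.Nullary.Negation using (¬¬-Monad; ¬¬-map)
open import Effect.Monad using (RawMonad)
open import Tactic.RingSolver using (solve-∀)
open import Tactic.RingSolver.Core.AlmostCommutativeRing using (AlmostCommutativeRing; fromCommutativeRing)
import Algebra.Properties.CommutativeMonoid.Sum as MonoidSum
import Algebra.Properties.Semiring.Sum as SemiringSum
open import Algebra.Properties.Group +-0-group using (⁻¹-involutive)
open import Algebra.Properties.CommutativeSemigroup (CommutativeMonoid.commutativeSemigroup +-0-commutativeMonoid)
  using (interchange)

ℚ-ring : AlmostCommutativeRing 0ℓ 0ℓ
ℚ-ring = fromCommutativeRing +-*-commutativeRing (λ x → dec⇒maybe (0ℚ ≟ x))

+-cancelˡ-≤ : ∀ a {b c} → a + b ≤ a + c → b ≤ c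
+-cancelˡ-≤ a {b} {c} a+b≤a+c = begin
  b             ≡⟨ cancel a b ⟩
  - a + (a + b) ≤⟨ +-monoʳ-≤ (- a) a+b≤a+c ⟩
  - a + (a + c) ≡⟨ sym (cancel a c) ⟩
  c             ∎
  where
  open ≤-Reasoning
  cancel : ∀ a x → x ≡ - a + (a + x)
  cancel = solve-∀ ℚ-ring

split-bound : ∀ {x y y′ z a b} → x ≤ y + a → x ≤ y′ + b → y + y′ ≡ x + z → x ≤ z + (a + b)
split-bound {x} {y} {y′} {z} {a} {b} x≤y+a x≤y′+b y+y′≡x+z = +-cancelˡ-≤ x (begin
  x + x                  ≤⟨ +-mono-≤ x≤y+a x≤y′+b ⟩
  (y + a) + (y′ + b)     ≡⟨ interchange y a y′ b ⟩
  (y + y′) + (a + b)     ≡⟨ cong (_+ (a + b)) y+y′≡x+z ⟩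
  (x + z) + (a + b)      ≡⟨ +-assoc x z (a + b) ⟩
  x + (z + (a + b))      ∎)
  where open ≤-Reasoning

<-⊓ : ∀ {a b c} → c < a → c < b → c < a ⊓ b
<-⊓ {a} {b} c<a c<b with ⊓-sel a b
... | inj₁ a⊓b≡a = subst (_ <_) (sym a⊓b≡a) c<a
... | inj₂ a⊓b≡b = subst (_ <_) (sym a⊓b≡b) c<b

-- Finite sums

open MonoidSum +-0-commutativeMonoid using (sum; ∑-distrib-+)
open SemiringSum (CommutativeRing.semiring +-*-commutativeRing) using (*-distribˡ-sum)

sumFin≡sum : ∀ k (g : Fin k → ℚ) → sumFin k g ≡ sum g
sumFin≡sum zero    g = refl
sumFin≡sum (suc k) g = cong (g zero +_) (sumFin≡sum k (g ∘ suc))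

sumFin-cong : ∀ k {f g : Fin k → ℚ} → (∀ i → f i ≡ g i) → sumFin k f ≡ sumFin k g
sumFin-cong zero    f≗g = refl
sumFin-cong (suc k) f≗g = cong₂ _+_ (f≗g zero) (sumFin-cong k (f≗g ∘ suc))

sumFin-zero : ∀ k {g : Fin k → ℚ} → (∀ i → g i ≡ 0ℚ) → sumFin k g ≡ 0ℚ
sumFin-zero zero    g≗0 = refl
sumFin-zero (suc k) g≗0 = trans (cong₂ _+_ (g≗0 zero) (sumFin-zero k (g≗0 ∘ suc))) (+-identityˡ 0ℚ)

sumFin-+ : ∀ k (f g : Fin k → ℚ) → sumFin k (λ i → f i + g i) ≡ sumFin k f + sumFin k g
sumFin-+ k f g = begin
  sumFin k (λ i → f i + g i) ≡⟨ sumFin≡sum k _ ⟩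
  sum (λ i → f i + g i)      ≡⟨ ∑-distrib-+ f g ⟩
  sum f + sum g              ≡⟨ sym (cong₂ _+_ (sumFin≡sum k f) (sumFin≡sum k g)) ⟩
  sumFin k f + sumFin k g    ∎
  where open ≡-Reasoning

sumFin-*ˡ : ∀ k a (g : Fin k → ℚ) → sumFin k (λ i → a * g i) ≡ a * sumFin k g
sumFin-*ˡ k a g = begin
  sumFin k (λ i → a * g i) ≡⟨ sumFin≡sum k _ ⟩
  sum (λ i → a * g i)      ≡⟨ sym (*-distribˡ-sum a g) ⟩
  a * sum g                ≡⟨ cong (a *_) (sym (sumFin≡sum k g)) ⟩
  a * sumFin k g           ∎
  where open ≡-Reasoning

sumFin-neg : ∀ k (g : Fin k → ℚ) → sumFin k (λ i → - g i) ≡ - sumFin k g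
sumFin-neg zero    g = refl
sumFin-neg (suc k) g =
  trans (cong (- g zero +_) (sumFin-neg k (g ∘ suc))) (sym (neg-distrib-+ (g zero) _))

sumFin-- : ∀ k (f g : Fin k → ℚ) → sumFin k (λ i → f i - g i) ≡ sumFin k f - sumFin k g
sumFin-- k f g = trans (sumFin-+ k f (λ i → - g i)) (cong (sumFin k f +_) (sumFin-neg k g))

sumFin-comm : ∀ k l (g : Fin k → Fin l → ℚ) →
              sumFin k (λ i → sumFin l (g i)) ≡ sumFin l (λ j → sumFin k (λ i → g i j))
sumFin-comm zero    l g = sym (sumFin-zero l (λ _ → refl))
sumFin-comm (suc k) l g =
  trans (cong (sumFin l (g zero) +_) (sumFin-comm k l (g ∘ suc))) (sym (sumFin-+ l (g zero) _))

sumFin-mono : ∀ k {f g : Fin k → ℚ} → (∀ i → f i ≤ g i) → sumFin k f ≤ sumFin k g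
sumFin-mono zero    f≤g = ≤-refl
sumFin-mono (suc k) f≤g = +-mono-≤ (f≤g zero) (sumFin-mono k (f≤g ∘ suc))

sumFin-nonneg : ∀ k {g : Fin k → ℚ} → (∀ i → 0ℚ ≤ g i) → 0ℚ ≤ sumFin k g
sumFin-nonneg k 0≤g = subst (_≤ sumFin k _) (sumFin-zero k (λ _ → refl)) (sumFin-mono k 0≤g)

term≤sumFin : ∀ k {g : Fin k → ℚ} → (∀ i → 0ℚ ≤ g i) → ∀ i → g i ≤ sumFin k g
term≤sumFin (suc k) {g} 0≤g zero    = begin
  g zero                        ≡⟨ sym (+-identityʳ (g zero)) ⟩
  g zero + 0ℚ                   ≤⟨ +-monoʳ-≤ (g zero) (sumFin-nonneg k (0≤g ∘ suc)) ⟩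
  g zero + sumFin k (g ∘ suc)   ∎
  where open ≤-Reasoning
term≤sumFin (suc k) {g} 0≤g (suc i) = begin
  g (suc i)                     ≤⟨ term≤sumFin k (0≤g ∘ suc) i ⟩
  sumFin k (g ∘ suc)            ≡⟨ sym (+-identityˡ _) ⟩
  0ℚ + sumFin k (g ∘ suc)       ≤⟨ +-monoˡ-≤ _ (0≤g zero) ⟩
  g zero + sumFin k (g ∘ suc)   ∎
  where open ≤-Reasoning

sumFin≡0⇒term≡0 : ∀ k {g : Fin k → ℚ} → (∀ i → 0ℚ ≤ g i) → sumFin k g ≡ 0ℚ →
                  ∀ i → g i ≡ 0ℚ
sumFin≡0⇒term≡0 k 0≤g Σg≡0 i = ≤-antisym (subst (_ ≤_) Σg≡0 (term≤sumFin k 0≤g i)) (0≤g i)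

sumFin-if : ∀ k b (g : Fin k → ℚ) →
            sumFin k (λ i → if b then g i else 0ℚ) ≡ (if b then sumFin k g else 0ℚ)
sumFin-if k true  g = refl
sumFin-if k false g = sumFin-zero k (λ _ → refl)

δ : ∀ {k} → Fin k → Fin k → ℚ
δ zero    zero    = 1ℚ
δ zero    (suc _) = 0ℚ
δ (suc _) zero    = 0ℚ
δ (suc a) (suc b) = δ a b

δ-diag : ∀ {k} (a : Fin k) → δ a a ≡ 1ℚ
δ-diag zero    = refl
δ-diag (suc a) = δ-diag a

δ-off : ∀ {k} {a b : Fin k} → a ≢ b → δ a b ≡ 0ℚ
δ-off {a = zero}  {zero}  a≢b = ⊥-elim (a≢b refl)
δ-off {a = zero}  {suc b} a≢b = refl
δ-off {a = suc a} {zero}  a≢b = refl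
δ-off {a = suc a} {suc b} a≢b = δ-off (a≢b ∘ cong suc)

sumFin-δ : ∀ k (a : Fin k) (g : Fin k → ℚ) → sumFin k (λ i → δ a i * g i) ≡ g a
sumFin-δ (suc k) zero g = begin
  1ℚ * g zero + sumFin k (λ i → 0ℚ * g (suc i))
    ≡⟨ cong₂ _+_ (*-identityˡ (g zero)) (sumFin-zero k (λ i → *-zeroˡ (g (suc i)))) ⟩
  g zero + 0ℚ                                   ≡⟨ +-identityʳ _ ⟩
  g zero                                        ∎
  where open ≡-Reasoning
sumFin-δ (suc k) (suc a) g =
  trans (cong₂ _+_ (*-zeroˡ (g zero)) (sumFin-δ k a (g ∘ suc))) (+-identityˡ _)

-- Conformal parts

Between : ℚ → ℚ → ℚ → Set
Between u v w = (u ≤ w × w ≤ v) ⊎ (v ≤ w × w ≤ u)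

Between-≤ : ∀ {u v w K} → Between u v w → u ≤ K → v ≤ K → w ≤ K
Between-≤ (inj₁ (_ , w≤v)) u≤K v≤K = ≤-trans w≤v v≤K
Between-≤ (inj₂ (_ , w≤u)) u≤K v≤K = ≤-trans w≤u u≤K

Between-≥ : ∀ {u v w K} → Between u v w → K ≤ u → K ≤ v → K ≤ w
Between-≥ (inj₁ (u≤w , _)) K≤u K≤v = ≤-trans K≤u u≤w
Between-≥ (inj₂ (v≤w , _)) K≤u K≤v = ≤-trans K≤v v≤w

Between-sym : ∀ {u v w} → Between u v w → Between v u w
Between-sym (inj₁ p) = inj₂ p
Between-sym (inj₂ p) = inj₁ p

Between-+ˡ : ∀ c {u v w} → Between u v w → Between (c + u) (c + v) (c + w)
Between-+ˡ c (inj₁ (u≤w , w≤v)) = inj₁ (+-monoʳ-≤ c u≤w , +-monoʳ-≤ c w≤v)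
Between-+ˡ c (inj₂ (v≤w , w≤u)) = inj₂ (+-monoʳ-≤ c v≤w , +-monoʳ-≤ c w≤u)

Between-neg : ∀ {u v w} → Between u v w → Between (- u) (- v) (- w)
Between-neg (inj₁ (u≤w , w≤v)) = inj₂ (neg-antimono-≤ w≤v , neg-antimono-≤ u≤w)
Between-neg (inj₂ (v≤w , w≤u)) = inj₁ (neg-antimono-≤ w≤u , neg-antimono-≤ v≤w)

infix 4 _≼_

_≼_ : ℚ → ℚ → Set
a ≼ b = Between 0ℚ b a

≼-refl : ∀ a → a ≼ a
≼-refl a with ≤-total 0ℚ a
... | inj₁ 0≤a = inj₁ (0≤a , ≤-refl)
... | inj₂ a≤0 = inj₂ (≤-refl , a≤0)

≼-trans : ∀ {a b c} → a ≼ b → b ≼ c → a ≼ c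
≼-trans (inj₁ (0≤a , a≤b)) (inj₁ (_ , b≤c))   = inj₁ (0≤a , ≤-trans a≤b b≤c)
≼-trans (inj₂ (b≤a , a≤0)) (inj₂ (c≤b , _))   = inj₂ (≤-trans c≤b b≤a , a≤0)
≼-trans (inj₁ (0≤a , a≤b)) (inj₂ (c≤b , b≤0)) =
  inj₂ (≤-trans c≤b (≤-trans b≤0 0≤a) , ≤-trans a≤b b≤0)
≼-trans (inj₂ (b≤a , a≤0)) (inj₁ (0≤b , b≤c)) =
  inj₁ (≤-trans 0≤b b≤a , ≤-trans a≤0 (≤-trans 0≤b b≤c))

≼-nonneg : ∀ {a b} → 0ℚ ≤ b → a ≼ b → 0ℚ ≤ a
≼-nonneg 0≤b a≼b = Between-≥ a≼b ≤-refl 0≤b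

≼-zero : ∀ {a} → a ≼ 0ℚ → a ≡ 0ℚ
≼-zero a≼0 = ≤-antisym (Between-≤ a≼0 ≤-refl ≤-refl) (Between-≥ a≼0 ≤-refl ≤-refl)

≼-complement : ∀ {a b} → a ≼ b → b - a ≼ b
≼-complement {a} {b} a≼b =
  Between-sym (subst₂ (λ u v → Between u v (b - a)) (+-identityʳ b) (+-inverseʳ b)
                      (Between-+ˡ b (Between-neg a≼b)))

≼-interpolate : ∀ {a u v} → a ≼ v - u → Between u v (u + a)
≼-interpolate {a} {u} {v} a≼v-u =
  subst₂ (λ u′ v′ → Between u′ v′ (u + a)) (+-identityʳ u) (u+[v-u]≡v u v) (Between-+ˡ u a≼v-u)
  where
  u+[v-u]≡v : ∀ u v → u + (v - u) ≡ v
  u+[v-u]≡v = solve-∀ ℚ-ring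

Shrinks : ℚ → ℚ → ℚ → Set
Shrinks d q b = d ≡ 0ℚ ⊎ (d ≡ - 1ℚ × b ≤ q) ⊎ (d ≡ 1ℚ × b ≤ - q)

Shrinks-mono : ∀ {d q b b′} → b′ ≤ b → Shrinks d q b → Shrinks d q b′
Shrinks-mono b′≤b (inj₁ d≡0)                 = inj₁ d≡0
Shrinks-mono b′≤b (inj₂ (inj₁ (d≡-1 , b≤q)))  = inj₂ (inj₁ (d≡-1 , ≤-trans b′≤b b≤q))
Shrinks-mono b′≤b (inj₂ (inj₂ (d≡1 , b≤-q)))  = inj₂ (inj₂ (d≡1 , ≤-trans b′≤b b≤-q))

Shrinks⇒≼ : ∀ {d q b ε} → 0ℚ ≤ ε → ε ≤ b → Shrinks d q b → q + ε * d ≼ q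
Shrinks⇒≼ {q = q} {ε = ε} 0≤ε ε≤b (inj₁ refl) =
  subst (_≼ q) (sym (trans (cong (q +_) (*-zeroʳ ε)) (+-identityʳ q))) (≼-refl q)
Shrinks⇒≼ {q = q} {ε = ε} 0≤ε ε≤b (inj₂ (inj₁ (refl , b≤q))) =
  subst (_≼ q) (q-ε≡q+ε*-1 q ε) (≼-complement (inj₁ (0≤ε , ≤-trans ε≤b b≤q)))
  where
  q-ε≡q+ε*-1 : ∀ q ε → q - ε ≡ q + ε * - 1ℚ
  q-ε≡q+ε*-1 = solve-∀ ℚ-ring
Shrinks⇒≼ {q = q} {ε = ε} 0≤ε ε≤b (inj₂ (inj₂ (refl , b≤-q))) =
  subst (_≼ q) (q--ε≡q+ε*1 q ε) (≼-complement (inj₂ (q≤-ε , neg-antimono-≤ 0≤ε)))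
  where
  q--ε≡q+ε*1 : ∀ q ε → q - - ε ≡ q + ε * 1ℚ
  q--ε≡q+ε*1 = solve-∀ ℚ-ring
  q≤-ε : q ≤ - ε
  q≤-ε = subst (_≤ - ε) (⁻¹-involutive q) (neg-antimono-≤ (≤-trans ε≤b b≤-q))

Tight : ℚ → ℚ → ℚ → Set
Tight d q b = (d ≡ - 1ℚ × b ≡ q) ⊎ (d ≡ 1ℚ × b ≡ - q)

Tight⇒zero : ∀ {d q b} → Tight d q b → q + b * d ≡ 0ℚ
Tight⇒zero {q = q} (inj₁ (refl , refl)) = q+q*-1≡0 q
  where
  q+q*-1≡0 : ∀ q → q + q * - 1ℚ ≡ 0ℚ
  q+q*-1≡0 = solve-∀ ℚ-ring
Tight⇒zero {q = q} (inj₂ (refl , refl)) = q+-q*1≡0 q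
  where
  q+-q*1≡0 : ∀ q → q + - q * 1ℚ ≡ 0ℚ
  q+-q*1≡0 = solve-∀ ℚ-ring

Tight⇒≢0 : ∀ {d q b} → Tight d q b → d ≢ 0ℚ
Tight⇒≢0 (inj₁ (refl , _)) ()
Tight⇒≢0 (inj₂ (refl , _)) ()

Tight⇒nonzero : ∀ {d q b} → 0ℚ < b → Tight d q b → q ≢ 0ℚ
Tight⇒nonzero 0<b (inj₁ (_ , refl)) refl = <-irrefl refl 0<b
Tight⇒nonzero 0<b (inj₂ (_ , refl)) refl = <-irrefl refl 0<b


-- Matrices

Matrix : ℕ → ℕ → Set
Matrix m n = Fin m → Fin n → ℚ

module _ {m n : ℕ} where

  infixl 6 _⊕_

  _⊕_ : Matrix m n → Matrix m n → Matrix m n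
  (M ⊕ N) i j = M i j + N i j

  rowSum : Matrix m n → Fin m → ℚ
  rowSum M i = sumFin n (M i)

  colSum : Matrix m n → Fin n → ℚ
  colSum M j = sumFin m (λ i → M i j)

  infix 4 _⊑_

  record _⊑_ (Q D : Matrix m n) : Set where
    field
      entry : ∀ i j → Q i j ≼ D i j
      row   : ∀ i → rowSum Q i ≼ rowSum D i
      col   : ∀ j → colSum Q j ≼ colSum D j

  open _⊑_ public

  ⊑-refl : ∀ {D} → D ⊑ D
  ⊑-refl = record { entry = λ i j → ≼-refl _ ; row = λ i → ≼-refl _ ; col = λ j → ≼-refl _ }

  ⊑-trans : ∀ {P Q D} → P ⊑ Q → Q ⊑ D → P ⊑ D
  ⊑-trans P⊑Q Q⊑D = record
    { entry = λ i j → ≼-trans (entry P⊑Q i j) (entry Q⊑D i j)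
    ; row   = λ i → ≼-trans (row P⊑Q i) (row Q⊑D i)
    ; col   = λ j → ≼-trans (col P⊑Q j) (col Q⊑D j)
    }

  ⊑-complement : ∀ {Q D} → Q ⊑ D → (λ i j → D i j - Q i j) ⊑ D
  ⊑-complement {Q} {D} Q⊑D = record
    { entry = λ i j → ≼-complement (entry Q⊑D i j)
    ; row   = λ i → subst (_≼ rowSum D i) (sym (sumFin-- n (D i) (Q i))) (≼-complement (row Q⊑D i))
    ; col   = λ j → subst (_≼ colSum D j) (sym (sumFin-- m (λ i → D i j) (λ i → Q i j)))
                          (≼-complement (col Q⊑D j))
    }

EqualOutside : ∀ {m n} → Subset m → Matrix m n → Matrix m n → Set
EqualOutside A Q′ Q = ∀ i j → i ∉ A → Q′ i j ≡ Q i j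

open MonoidSum ℕ.+-0-commutativeMonoid using () renaming (sum to sumℕ)

sumℕ-mono : ∀ {k} {f g : Fin k → ℕ} → (∀ i → f i ℕ.≤ g i) → sumℕ f ℕ.≤ sumℕ g
sumℕ-mono {zero}  f≤g = ℕ.z≤n
sumℕ-mono {suc k} f≤g = ℕ.+-mono-≤ (f≤g zero) (sumℕ-mono (f≤g ∘ suc))

sumℕ-mono-< : ∀ {k} {f g : Fin k → ℕ} → (∀ i → f i ℕ.≤ g i) →
              ∀ i → f i ℕ.< g i → sumℕ f ℕ.< sumℕ g
sumℕ-mono-< {suc k} f≤g zero    f<g = ℕ.+-mono-<-≤ f<g (sumℕ-mono (f≤g ∘ suc))
sumℕ-mono-< {suc k} f≤g (suc i) f<g = ℕ.+-mono-≤-< (f≤g zero) (sumℕ-mono-< (f≤g ∘ suc) i f<g)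

nonzero : ℚ → ℕ
nonzero a = if does (a ≟ 0ℚ) then 0 else 1

nonzero-mono : ∀ {a b} → a ≼ b → nonzero a ℕ.≤ nonzero b
nonzero-mono {a} {b} a≼b with a ≟ 0ℚ | b ≟ 0ℚ
... | yes _   | _        = ℕ.z≤n
... | no _    | no _     = ℕ.≤-refl
... | no a≢0  | yes refl = ⊥-elim (a≢0 (≼-zero a≼b))

nonzero-< : ∀ {a b} → a ≡ 0ℚ → b ≢ 0ℚ → nonzero a ℕ.< nonzero b
nonzero-< {a} {b} a≡0 b≢0 with a ≟ 0ℚ | b ≟ 0ℚ
... | yes _   | no _     = ℕ.s≤s ℕ.z≤n
... | no a≢0  | _        = ⊥-elim (a≢0 a≡0)
... | _       | yes b≡0  = ⊥-elim (b≢0 b≡0)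

support : ∀ k → (Fin k → ℚ) → ℕ
support k g = sumℕ (nonzero ∘ g)

module _ {m n : ℕ} where

  size : Matrix m n → ℕ
  size M = sumℕ (λ i → support n (M i)) ℕ.+ (support m (rowSum M) ℕ.+ support n (colSum M))

  data ZeroCreated (Q′ Q : Matrix m n) : Set where
    at-entry : ∀ i j → Q′ i j ≡ 0ℚ → Q i j ≢ 0ℚ → ZeroCreated Q′ Q
    at-row   : ∀ i → rowSum Q′ i ≡ 0ℚ → rowSum Q i ≢ 0ℚ → ZeroCreated Q′ Q
    at-col   : ∀ j → colSum Q′ j ≡ 0ℚ → colSum Q j ≢ 0ℚ → ZeroCreated Q′ Q

  module _ {Q′ Q : Matrix m n} (Q′⊑Q : Q′ ⊑ Q) where

    private
      entry≤ : ∀ i j → nonzero (Q′ i j) ℕ.≤ nonzero (Q i j)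
      entry≤ i = nonzero-mono ∘ entry Q′⊑Q i
      entries≤ : ∀ i → support n (Q′ i) ℕ.≤ support n (Q i)
      entries≤ = sumℕ-mono ∘ entry≤
      rows≤ : ∀ i → nonzero (rowSum Q′ i) ℕ.≤ nonzero (rowSum Q i)
      rows≤ = nonzero-mono ∘ row Q′⊑Q
      cols≤ : ∀ j → nonzero (colSum Q′ j) ℕ.≤ nonzero (colSum Q j)
      cols≤ = nonzero-mono ∘ col Q′⊑Q

    size-< : ZeroCreated Q′ Q → size Q′ ℕ.< size Q
    size-< (at-entry i j Q′≡0 Q≢0) = ℕ.+-mono-<-≤
      (sumℕ-mono-< entries≤ i (sumℕ-mono-< (entry≤ i) j (nonzero-< Q′≡0 Q≢0)))
      (ℕ.+-mono-≤ (sumℕ-mono rows≤) (sumℕ-mono cols≤))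
    size-< (at-row i Q′≡0 Q≢0) = ℕ.+-mono-≤-< (sumℕ-mono entries≤)
      (ℕ.+-mono-<-≤ (sumℕ-mono-< rows≤ i (nonzero-< Q′≡0 Q≢0)) (sumℕ-mono cols≤))
    size-< (at-col j Q′≡0 Q≢0) = ℕ.+-mono-≤-< (sumℕ-mono entries≤)
      (ℕ.+-mono-≤-< (sumℕ-mono rows≤) (sumℕ-mono-< cols≤ j (nonzero-< Q′≡0 Q≢0)))

module _ {m n : ℕ} where

  unit : Fin m → Fin n → Matrix m n
  unit a b i j = δ a i * δ b j

  unit-diag : ∀ a b → unit a b a b ≡ 1ℚ
  unit-diag a b = cong₂ _*_ (δ-diag a) (δ-diag b)

  unit-offˡ : ∀ {a i} b j → a ≢ i → unit a b i j ≡ 0ℚ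
  unit-offˡ {a} {i} b j a≢i = trans (cong (_* δ b j) (δ-off a≢i)) (*-zeroˡ (δ b j))

  unit-offʳ : ∀ a i {b j} → b ≢ j → unit a b i j ≡ 0ℚ
  unit-offʳ a i {b} {j} b≢j = trans (cong (δ a i *_) (δ-off b≢j)) (*-zeroʳ (δ a i))

  unit-cases : ∀ a b i j → (a ≡ i × b ≡ j) ⊎ unit a b i j ≡ 0ℚ
  unit-cases a b i j with a ≟ᶠ i | b ≟ᶠ j
  ... | yes a≡i | yes b≡j = inj₁ (a≡i , b≡j)
  ... | no  a≢i | _       = inj₂ (unit-offˡ b j a≢i)
  ... | yes _   | no  b≢j = inj₂ (unit-offʳ a i b≢j)

  rowSum-unit : ∀ a b i → rowSum (unit a b) i ≡ δ a i
  rowSum-unit a b i = begin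
    sumFin n (λ j → δ a i * δ b j)  ≡⟨ sumFin-cong n (λ j → *-comm (δ a i) (δ b j)) ⟩
    sumFin n (λ j → δ b j * δ a i)  ≡⟨ sumFin-δ n b (λ _ → δ a i) ⟩
    δ a i                           ∎
    where open ≡-Reasoning

  colSum-unit : ∀ a b j → colSum (unit a b) j ≡ δ b j
  colSum-unit a b j = sumFin-δ m a (λ _ → δ b j)

-- Augmenting paths

module ¬¬ = RawMonad (¬¬-Monad {0ℓ})

¬¬-decide-Fin : ∀ k (P : Fin k → Set) → ¬ ¬ (∀ i → Dec (P i))
¬¬-decide-Fin zero    P = ¬¬.pure λ ()
¬¬-decide-Fin (suc k) P = do
  P₀? ← ¬¬-excluded-middle
  Pₛ? ← ¬¬-decide-Fin k (P ∘ suc)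
  ¬¬.pure λ { zero → P₀? ; (suc i) → Pₛ? i }
  where open ¬¬

module Augmentation {m n : ℕ} (A : Subset m) {t : Fin m} (t∈A : t ∈ A) (Q : Matrix m n) where

  Node : Set
  Node = Fin m ⊎ Fin n

  _≟ₙ_ : (v w : Node) → Dec (v ≡ w)
  _≟ₙ_ = ≡-dec _≟ᶠ_ _≟ᶠ_

  -- Forward edges follow positive entries and backward edges negative ones, so pushing flow along a
  -- path (Δ below) moves every entry it touches towards 0.
  data Path : Node → Set where
    start    : Path (inj₁ t)
    forward  : ∀ {i} → Path (inj₁ i) → ∀ j → 0ℚ < Q i j → Path (inj₂ j)
    backward : ∀ {j} → Path (inj₂ j) → ∀ i → i ∈ A → Q i j < 0ℚ → Path (inj₁ i)

  infix 4 _∈ₚ_ _∉ₚ_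

  _∈ₚ_ : ∀ {v} → Node → Path v → Set
  w ∈ₚ start            = w ≡ inj₁ t
  w ∈ₚ forward p j _    = w ≡ inj₂ j ⊎ w ∈ₚ p
  w ∈ₚ backward p i _ _ = w ≡ inj₁ i ⊎ w ∈ₚ p

  _∉ₚ_ : ∀ {v} → Node → Path v → Set
  w ∉ₚ p = ¬ w ∈ₚ p

  _∈ₚ?_ : ∀ {v} (w : Node) (p : Path v) → Dec (w ∈ₚ p)
  w ∈ₚ? start            = w ≟ₙ inj₁ t
  w ∈ₚ? forward p j _    = (w ≟ₙ inj₂ j) ⊎-dec (w ∈ₚ? p)
  w ∈ₚ? backward p i _ _ = (w ≟ₙ inj₁ i) ⊎-dec (w ∈ₚ? p)

  end∈ₚ : ∀ {v} (p : Path v) → v ∈ₚ p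
  end∈ₚ start              = refl
  end∈ₚ (forward _ _ _)    = inj₁ refl
  end∈ₚ (backward _ _ _ _) = inj₁ refl

  end∈A : ∀ {i} → Path (inj₁ i) → i ∈ A
  end∈A start                = t∈A
  end∈A (backward _ _ i∈A _) = i∈A

  Simple : ∀ {v} → Path v → Set
  Simple start              = ⊤
  Simple (forward p j _)    = inj₂ j ∉ₚ p × Simple p
  Simple (backward p i _ _) = inj₁ i ∉ₚ p × Simple p

  SimplePath : Node → Set
  SimplePath v = Σ (Path v) Simple

  truncate : ∀ {v w} (p : Path v) → Simple p → w ∈ₚ p → SimplePath w
  truncate start                 _       refl        = start , tt
  truncate p@(forward _ _ _)     s       (inj₁ refl) = p , s
  truncate (forward p _ _)       (_ , s) (inj₂ w∈p)  = truncate p s w∈p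
  truncate p@(backward _ _ _ _)  s       (inj₁ refl) = p , s
  truncate (backward p _ _ _)    (_ , s) (inj₂ w∈p)  = truncate p s w∈p

  extend-forward : ∀ {i} → SimplePath (inj₁ i) → ∀ j → 0ℚ < Q i j → SimplePath (inj₂ j)
  extend-forward (p , s) j 0<Q with inj₂ j ∈ₚ? p
  ... | yes j∈p = truncate p s j∈p
  ... | no  j∉p = forward p j 0<Q , j∉p , s

  extend-backward : ∀ {j} → SimplePath (inj₂ j) → ∀ i → i ∈ A → Q i j < 0ℚ → SimplePath (inj₁ i)
  extend-backward (p , s) i i∈A Q<0 with inj₁ i ∈ₚ? p
  ... | yes i∈p = truncate p s i∈p
  ... | no  i∉p = backward p i i∈A Q<0 , i∉p , s

  Δ : ∀ {v} → Path v → Matrix m n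
  Δ start                    i j = 0ℚ
  Δ (forward {i₀} p j₀ _)    i j = Δ p i j - unit i₀ j₀ i j
  Δ (backward {j₀} p i₀ _ _) i j = Δ p i j + unit i₀ j₀ i j

  Δ-unvisited-client : ∀ {v} (p : Path v) {i j} → inj₂ j ∉ₚ p → Δ p i j ≡ 0ℚ
  Δ-unvisited-client start                     j∉p = refl
  Δ-unvisited-client (forward {i₀} p j₀ _) {i} j∉p = cong₂ _-_
    (Δ-unvisited-client p (j∉p ∘ inj₂)) (unit-offʳ i₀ i (j∉p ∘ inj₁ ∘ cong inj₂ ∘ sym))
  Δ-unvisited-client (backward {j₀} p i₀ _ _) {i} j∉p = cong₂ _+_
    (Δ-unvisited-client p (j∉p ∘ inj₂))
    (unit-offʳ i₀ i (λ j₀≡j → j∉p (inj₂ (subst (λ k → inj₂ k ∈ₚ p) j₀≡j (end∈ₚ p)))))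

  Δ-unvisited-facility : ∀ {v} (p : Path v) {i j} → inj₁ i ∉ₚ p → Δ p i j ≡ 0ℚ
  Δ-unvisited-facility start                     i∉p = refl
  Δ-unvisited-facility (forward {i₀} p j₀ _) {i} {j} i∉p = cong₂ _-_
    (Δ-unvisited-facility p (i∉p ∘ inj₂))
    (unit-offˡ j₀ j (λ i₀≡i → i∉p (inj₂ (subst (λ k → inj₁ k ∈ₚ p) i₀≡i (end∈ₚ p)))))
  Δ-unvisited-facility (backward {j₀} p i₀ _ _) {i} {j} i∉p = cong₂ _+_
    (Δ-unvisited-facility p (i∉p ∘ inj₂)) (unit-offˡ j₀ j (i∉p ∘ inj₁ ∘ cong inj₁ ∘ sym))

  Δ-outside : ∀ {v} (p : Path v) {i} j → i ∉ A → Δ p i j ≡ 0ℚ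
  Δ-outside start                      j i∉A = refl
  Δ-outside (forward {i₀} p j₀ _)      j i∉A = cong₂ _-_
    (Δ-outside p j i∉A) (unit-offˡ j₀ j (λ i₀≡i → i∉A (subst (_∈ A) i₀≡i (end∈A p))))
  Δ-outside (backward {j₀} p i₀ i₀∈A _) j i∉A = cong₂ _+_
    (Δ-outside p j i∉A) (unit-offˡ j₀ j (λ i₀≡i → i∉A (subst (_∈ A) i₀≡i i₀∈A)))

  facilityAt : Node → Fin m → ℚ
  facilityAt (inj₁ a) i = δ a i
  facilityAt (inj₂ _) i = 0ℚ

  clientAt : Node → Fin n → ℚ
  clientAt (inj₁ _) j = 0ℚ
  clientAt (inj₂ b) j = δ b j

  rowSum-Δ : ∀ {v} (p : Path v) i → rowSum (Δ p) i ≡ facilityAt v i - δ t i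
  rowSum-Δ start i = trans (sumFin-zero n (λ _ → refl)) (sym (+-inverseʳ (δ t i)))
  rowSum-Δ (forward {i₀} p j₀ _) i = begin
    sumFin n (λ j → Δ p i j - unit i₀ j₀ i j)  ≡⟨ sumFin-- n (Δ p i) (unit i₀ j₀ i) ⟩
    rowSum (Δ p) i - rowSum (unit i₀ j₀) i    ≡⟨ cong₂ _-_ (rowSum-Δ p i) (rowSum-unit i₀ j₀ i) ⟩
    (δ i₀ i - δ t i) - δ i₀ i                 ≡⟨ [a-b]-a≡0-b (δ i₀ i) (δ t i) ⟩
    0ℚ - δ t i                                ∎
    where
    open ≡-Reasoning
    [a-b]-a≡0-b : ∀ a b → (a - b) - a ≡ 0ℚ - b
    [a-b]-a≡0-b = solve-∀ ℚ-ring
  rowSum-Δ (backward {j₀} p i₀ _ _) i = begin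
    sumFin n (λ j → Δ p i j + unit i₀ j₀ i j)  ≡⟨ sumFin-+ n (Δ p i) (unit i₀ j₀ i) ⟩
    rowSum (Δ p) i + rowSum (unit i₀ j₀) i    ≡⟨ cong₂ _+_ (rowSum-Δ p i) (rowSum-unit i₀ j₀ i) ⟩
    (0ℚ - δ t i) + δ i₀ i                     ≡⟨ [0-b]+a≡a-b (δ i₀ i) (δ t i) ⟩
    δ i₀ i - δ t i                            ∎
    where
    open ≡-Reasoning
    [0-b]+a≡a-b : ∀ a b → (0ℚ - b) + a ≡ a - b
    [0-b]+a≡a-b = solve-∀ ℚ-ring

  colSum-Δ : ∀ {v} (p : Path v) j → colSum (Δ p) j ≡ - clientAt v j
  colSum-Δ start j = sumFin-zero m (λ _ → refl)
  colSum-Δ (forward {i₀} p j₀ _) j = begin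
    sumFin m (λ i → Δ p i j - unit i₀ j₀ i j)  ≡⟨ sumFin-- m (λ i → Δ p i j) (λ i → unit i₀ j₀ i j) ⟩
    colSum (Δ p) j - colSum (unit i₀ j₀) j    ≡⟨ cong₂ _-_ (colSum-Δ p j) (colSum-unit i₀ j₀ j) ⟩
    - 0ℚ - δ j₀ j                             ≡⟨ +-identityˡ (- δ j₀ j) ⟩
    - δ j₀ j                                  ∎
    where open ≡-Reasoning
  colSum-Δ (backward {j₀} p i₀ _ _) j = begin
    sumFin m (λ i → Δ p i j + unit i₀ j₀ i j)  ≡⟨ sumFin-+ m (λ i → Δ p i j) (λ i → unit i₀ j₀ i j) ⟩
    colSum (Δ p) j + colSum (unit i₀ j₀) j    ≡⟨ cong₂ _+_ (colSum-Δ p j) (colSum-unit i₀ j₀ j) ⟩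
    - δ j₀ j + δ j₀ j                         ≡⟨ +-inverseˡ (δ j₀ j) ⟩
    - 0ℚ                                      ∎
    where open ≡-Reasoning

  bottleneck : ∀ {v} → Path v → ℚ
  bottleneck start                  = rowSum Q t
  bottleneck (forward {i} p j _)    = bottleneck p ⊓ Q i j
  bottleneck (backward {j} p i _ _) = bottleneck p ⊓ - Q i j

  bottleneck≤source : ∀ {v} (p : Path v) → bottleneck p ≤ rowSum Q t
  bottleneck≤source start              = ≤-refl
  bottleneck≤source (forward p _ _)    = p≤q⇒p⊓r≤q _ (bottleneck≤source p)
  bottleneck≤source (backward p _ _ _) = p≤q⇒p⊓r≤q _ (bottleneck≤source p)

  bottleneck-pos : 0ℚ < rowSum Q t → ∀ {v} (p : Path v) → 0ℚ < bottleneck p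
  bottleneck-pos 0<src start                  = 0<src
  bottleneck-pos 0<src (forward p _ 0<Q)      = <-⊓ (bottleneck-pos 0<src p) 0<Q
  bottleneck-pos 0<src (backward p _ _ Q<0)   = <-⊓ (bottleneck-pos 0<src p) (neg-antimono-< Q<0)

  module _ {i₀ : Fin m} {j₀ : Fin n} {i : Fin m} {j : Fin n} where

    Δ-forward-off : ∀ (p : Path (inj₁ i₀)) 0<Q → unit i₀ j₀ i j ≡ 0ℚ →
                    Δ (forward p j₀ 0<Q) i j ≡ Δ p i j
    Δ-forward-off p _ unit≡0 = trans (cong (λ u → Δ p i j - u) unit≡0) (+-identityʳ (Δ p i j))

    Δ-backward-off : ∀ (p : Path (inj₂ j₀)) i₀∈A Q<0 → unit i₀ j₀ i j ≡ 0ℚ →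
                     Δ (backward p i₀ i₀∈A Q<0) i j ≡ Δ p i j
    Δ-backward-off p _ _ unit≡0 = trans (cong (Δ p i j +_) unit≡0) (+-identityʳ (Δ p i j))

  Δ-shrinks : ∀ {v} (p : Path v) → Simple p → ∀ i j → Shrinks (Δ p i j) (Q i j) (bottleneck p)
  Δ-shrinks start _ i j = inj₁ refl
  Δ-shrinks (forward {i₀} p j₀ 0<Q) (j₀∉p , s) i j with unit-cases i₀ j₀ i j
  ... | inj₁ (refl , refl) =
    inj₂ (inj₁ (cong₂ _-_ (Δ-unvisited-client p j₀∉p) (unit-diag i₀ j₀) , p⊓q≤q (bottleneck p) _))
  ... | inj₂ unit≡0 = subst (λ d → Shrinks d (Q i j) _) (sym (Δ-forward-off p 0<Q unit≡0))
                            (Shrinks-mono (p⊓q≤p (bottleneck p) _) (Δ-shrinks p s i j))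
  Δ-shrinks (backward {j₀} p i₀ i₀∈A Q<0) (i₀∉p , s) i j with unit-cases i₀ j₀ i j
  ... | inj₁ (refl , refl) =
    inj₂ (inj₂ (cong₂ _+_ (Δ-unvisited-facility p i₀∉p) (unit-diag i₀ j₀) , p⊓q≤q (bottleneck p) _))
  ... | inj₂ unit≡0 = subst (λ d → Shrinks d (Q i j) _) (sym (Δ-backward-off p i₀∈A Q<0 unit≡0))
                            (Shrinks-mono (p⊓q≤p (bottleneck p) _) (Δ-shrinks p s i j))

  bottleneck-tight : ∀ {v} (p : Path v) → Simple p →
    bottleneck p ≡ rowSum Q t ⊎ Σ[ i ∈ Fin m ] Σ[ j ∈ Fin n ] Tight (Δ p i j) (Q i j) (bottleneck p)
  bottleneck-tight start _ = inj₁ refl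
  bottleneck-tight (forward {i₀} p j₀ 0<Q) (j₀∉p , s) with ⊓-sel (bottleneck p) (Q i₀ j₀)
  ... | inj₂ b⊓Q≡Q =
    inj₂ (i₀ , j₀ , inj₁ (cong₂ _-_ (Δ-unvisited-client p j₀∉p) (unit-diag i₀ j₀) , b⊓Q≡Q))
  ... | inj₁ b⊓Q≡b with bottleneck-tight p s
  ...   | inj₁ b≡src = inj₁ (trans b⊓Q≡b b≡src)
  ...   | inj₂ (i , j , tight) with unit-cases i₀ j₀ i j
  ...     | inj₁ (refl , refl) = ⊥-elim (Tight⇒≢0 tight (Δ-unvisited-client p j₀∉p))
  ...     | inj₂ unit≡0 = inj₂ (i , j , subst₂ (λ d b → Tight d (Q i j) b)
                                         (sym (Δ-forward-off p 0<Q unit≡0)) (sym b⊓Q≡b) tight)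
  bottleneck-tight (backward {j₀} p i₀ i₀∈A Q<0) (i₀∉p , s) with ⊓-sel (bottleneck p) (- Q i₀ j₀)
  ... | inj₂ b⊓Q≡-Q =
    inj₂ (i₀ , j₀ , inj₂ (cong₂ _+_ (Δ-unvisited-facility p i₀∉p) (unit-diag i₀ j₀) , b⊓Q≡-Q))
  ... | inj₁ b⊓Q≡b with bottleneck-tight p s
  ...   | inj₁ b≡src = inj₁ (trans b⊓Q≡b b≡src)
  ...   | inj₂ (i , j , tight) with unit-cases i₀ j₀ i j
  ...     | inj₁ (refl , refl) = ⊥-elim (Tight⇒≢0 tight (Δ-unvisited-facility p i₀∉p))
  ...     | inj₂ unit≡0 = inj₂ (i , j , subst₂ (λ d b → Tight d (Q i j) b)
                                         (sym (Δ-backward-off p i₀∈A Q<0 unit≡0)) (sym b⊓Q≡b) tight)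

  End : Node → Set
  End (inj₁ i) = rowSum Q i < 0ℚ
  End (inj₂ j) = 0ℚ < colSum Q j

  slack : Node → ℚ
  slack (inj₁ i) = - rowSum Q i
  slack (inj₂ j) = colSum Q j

  push : ∀ {v} → Path v → ℚ → Matrix m n
  push p ε i j = Q i j + ε * Δ p i j

  rowSum-push : ∀ {v} (p : Path v) ε i → rowSum (push p ε) i ≡ rowSum Q i + ε * (facilityAt v i - δ t i)
  rowSum-push {v} p ε i = begin
    sumFin n (λ j → Q i j + ε * Δ p i j)  ≡⟨ sumFin-+ n (Q i) (λ j → ε * Δ p i j) ⟩
    rowSum Q i + sumFin n (λ j → ε * Δ p i j)  ≡⟨ cong (rowSum Q i +_) (sumFin-*ˡ n ε (Δ p i)) ⟩
    rowSum Q i + ε * rowSum (Δ p) i  ≡⟨ cong (λ r → rowSum Q i + ε * r) (rowSum-Δ p i) ⟩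
    rowSum Q i + ε * (facilityAt v i - δ t i)  ∎
    where open ≡-Reasoning

  colSum-push : ∀ {v} (p : Path v) ε j → colSum (push p ε) j ≡ colSum Q j + ε * - clientAt v j
  colSum-push {v} p ε j = begin
    sumFin m (λ i → Q i j + ε * Δ p i j)  ≡⟨ sumFin-+ m (λ i → Q i j) (λ i → ε * Δ p i j) ⟩
    colSum Q j + sumFin m (λ i → ε * Δ p i j)  ≡⟨ cong (colSum Q j +_) (sumFin-*ˡ m ε (λ i → Δ p i j)) ⟩
    colSum Q j + ε * colSum (Δ p) j  ≡⟨ cong (λ c → colSum Q j + ε * c) (colSum-Δ p j) ⟩
    colSum Q j + ε * - clientAt v j  ∎
    where open ≡-Reasoning

  push-outside : ∀ {v} (p : Path v) ε → EqualOutside A (push p ε) Q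
  push-outside p ε i j i∉A =
    trans (cong (λ d → Q i j + ε * d) (Δ-outside p j i∉A))
          (trans (cong (Q i j +_) (*-zeroʳ ε)) (+-identityʳ (Q i j)))

  facilityAt-source : ∀ e → e ≢ inj₁ t → facilityAt e t ≡ 0ℚ
  facilityAt-source (inj₁ a) a≢t = δ-off (a≢t ∘ cong inj₁)
  facilityAt-source (inj₂ _) _   = refl

  facility-shrinks : ∀ e {ε} → ε ≤ slack e → ∀ i → Shrinks (facilityAt e i) (rowSum Q i) ε
  facility-shrinks (inj₂ _) ε≤slack i = inj₁ refl
  facility-shrinks (inj₁ a) ε≤slack i with a ≟ᶠ i
  ... | yes refl = inj₂ (inj₂ (δ-diag a , ε≤slack))
  ... | no a≢i   = inj₁ (δ-off a≢i)

  row-shrinks : ∀ e {ε} → e ≢ inj₁ t → ε ≤ rowSum Q t → ε ≤ slack e →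
                ∀ i → Shrinks (facilityAt e i - δ t i) (rowSum Q i) ε
  row-shrinks e e≢t ε≤src ε≤slack i with t ≟ᶠ i
  ... | yes refl = inj₂ (inj₁ (cong₂ _-_ (facilityAt-source e e≢t) (δ-diag t) , ε≤src))
  ... | no t≢i = subst (λ d → Shrinks d (rowSum Q i) _)
                       (sym (trans (cong (λ d → facilityAt e i - d) (δ-off t≢i)) (+-identityʳ _)))
                       (facility-shrinks e ε≤slack i)

  col-shrinks : ∀ e {ε} → ε ≤ slack e → ∀ j → Shrinks (- clientAt e j) (colSum Q j) ε
  col-shrinks (inj₁ _) ε≤slack j = inj₁ refl
  col-shrinks (inj₂ b) ε≤slack j with b ≟ᶠ j
  ... | yes refl = inj₂ (inj₁ (cong -_ (δ-diag b) , ε≤slack))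
  ... | no b≢j   = inj₁ (cong -_ (δ-off b≢j))

  push-⊑ : ∀ {e} (p : Path e) → Simple p → e ≢ inj₁ t →
           ∀ {ε} → 0ℚ ≤ ε → ε ≤ bottleneck p → ε ≤ slack e → push p ε ⊑ Q
  push-⊑ {e} p simple e≢t {ε} 0≤ε ε≤b ε≤slack = record
    { entry = λ i j → Shrinks⇒≼ 0≤ε ε≤b (Δ-shrinks p simple i j)
    ; row   = λ i → subst (_≼ rowSum Q i) (sym (rowSum-push p ε i))
                      (Shrinks⇒≼ 0≤ε ≤-refl
                        (row-shrinks e e≢t (≤-trans ε≤b (bottleneck≤source p)) ε≤slack i))
    ; col   = λ j → subst (_≼ colSum Q j) (sym (colSum-push p ε j))
                      (Shrinks⇒≼ 0≤ε ≤-refl (col-shrinks e ε≤slack j))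
    }

  slack-pos : ∀ e → End e → 0ℚ < slack e
  slack-pos (inj₁ i) end = neg-antimono-< end
  slack-pos (inj₂ j) end = end

  slack-zeroes : ∀ {e} (p : Path e) → End e → e ≢ inj₁ t → ZeroCreated (push p (slack e)) Q
  slack-zeroes {inj₁ a} p end a≢t = at-row a (begin
    rowSum (push p (- rowSum Q a)) a                  ≡⟨ rowSum-push p (- rowSum Q a) a ⟩
    rowSum Q a + - rowSum Q a * (δ a a - δ t a)       ≡⟨ cong₂ (λ x y → rowSum Q a + - rowSum Q a * (x - y))
                                                               (δ-diag a) (δ-off (a≢t ∘ cong inj₁ ∘ sym)) ⟩
    rowSum Q a + - rowSum Q a * (1ℚ - 0ℚ)             ≡⟨ r+-r*[1-0]≡0 (rowSum Q a) ⟩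
    0ℚ                                                ∎) (<⇒≢ end)
    where
    open ≡-Reasoning
    r+-r*[1-0]≡0 : ∀ r → r + - r * (1ℚ - 0ℚ) ≡ 0ℚ
    r+-r*[1-0]≡0 = solve-∀ ℚ-ring
  slack-zeroes {inj₂ b} p end _ = at-col b (begin
    colSum (push p (colSum Q b)) b     ≡⟨ colSum-push p (colSum Q b) b ⟩
    colSum Q b + colSum Q b * - δ b b  ≡⟨ cong (λ x → colSum Q b + colSum Q b * - x) (δ-diag b) ⟩
    colSum Q b + colSum Q b * - 1ℚ     ≡⟨ c+c*-1≡0 (colSum Q b) ⟩
    0ℚ                                 ∎) (≢-sym (<⇒≢ end))
    where
    open ≡-Reasoning
    c+c*-1≡0 : ∀ c → c + c * - 1ℚ ≡ 0ℚ
    c+c*-1≡0 = solve-∀ ℚ-ring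

  source-zeroes : ∀ {e} (p : Path e) → e ≢ inj₁ t → 0ℚ < rowSum Q t →
                  ZeroCreated (push p (rowSum Q t)) Q
  source-zeroes {e} p e≢t 0<src = at-row t (begin
    rowSum (push p (rowSum Q t)) t                   ≡⟨ rowSum-push p (rowSum Q t) t ⟩
    rowSum Q t + rowSum Q t * (facilityAt e t - δ t t) ≡⟨ cong₂ (λ x y → rowSum Q t + rowSum Q t * (x - y))
                                                               (facilityAt-source e e≢t) (δ-diag t) ⟩
    rowSum Q t + rowSum Q t * (0ℚ - 1ℚ)              ≡⟨ r+r*[0-1]≡0 (rowSum Q t) ⟩
    0ℚ                                               ∎) (≢-sym (<⇒≢ 0<src))
    where
    open ≡-Reasoning
    r+r*[0-1]≡0 : ∀ r → r + r * (0ℚ - 1ℚ) ≡ 0ℚ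
    r+r*[0-1]≡0 = solve-∀ ℚ-ring

  augment : 0ℚ < rowSum Q t → ∀ {e} → End e → SimplePath e →
            Σ[ Q′ ∈ Matrix m n ] (Q′ ⊑ Q × EqualOutside A Q′ Q × size Q′ ℕ.< size Q)
  augment 0<src {e} end (p , simple) = push p ε , Q′⊑Q , push-outside p ε , size-< Q′⊑Q zero-created
    where
    ε : ℚ
    ε = bottleneck p ⊓ slack e
    e≢t : e ≢ inj₁ t
    e≢t refl = <-asym end 0<src
    0<ε : 0ℚ < ε
    0<ε = <-⊓ (bottleneck-pos 0<src p) (slack-pos e end)
    Q′⊑Q : push p ε ⊑ Q
    Q′⊑Q = push-⊑ p simple e≢t (<⇒≤ 0<ε) (p⊓q≤p (bottleneck p) _) (p⊓q≤q (bottleneck p) _)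
    zero-created : ZeroCreated (push p ε) Q
    zero-created with ⊓-sel (bottleneck p) (slack e)
    ... | inj₂ ε≡slack = subst (λ ε → ZeroCreated (push p ε) Q) (sym ε≡slack) (slack-zeroes p end e≢t)
    ... | inj₁ ε≡b with bottleneck-tight p simple
    ...   | inj₁ b≡src = subst (λ ε → ZeroCreated (push p ε) Q) (sym (trans ε≡b b≡src))
                               (source-zeroes p e≢t 0<src)
    ...   | inj₂ (i , j , tight) = at-entry i j (Tight⇒zero tight′) (Tight⇒nonzero 0<ε tight′)
      where
      tight′ : Tight (Δ p i j) (Q i j) ε
      tight′ = subst (Tight (Δ p i j) (Q i j)) (sym ε≡b) tight

  ReachableEnd : Set
  ReachableEnd = Σ[ e ∈ Node ] (End e × SimplePath e)

  -- If no end were reachable, the reachable nodes would form a cut that no edge leaves with positive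
  -- flow (edge-outflow≤0), yet, containing the source and no end, with net outflow ≥ rowSum Q t > 0.
  module Cut (Q-outside : ∀ i j → i ∉ A → 0ℚ ≤ Q i j)
             (no-end : ¬ ReachableEnd)
             (reach₁ : ∀ i → Dec (SimplePath (inj₁ i))) (reach₂ : ∀ j → Dec (SimplePath (inj₂ j))) where

    inside₁ : Fin m → ℚ → ℚ
    inside₁ i a = if does (reach₁ i) then a else 0ℚ

    inside₂ : Fin n → ℚ → ℚ
    inside₂ j a = if does (reach₂ j) then a else 0ℚ

    net-outflow : ℚ
    net-outflow = sumFin m (λ i → inside₁ i (rowSum Q i)) - sumFin n (λ j → inside₂ j (colSum Q j))

    edge-outflow≤0 : ∀ i j → inside₁ i (Q i j) - inside₂ j (Q i j) ≤ 0ℚ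
    edge-outflow≤0 i j with reach₁ i | reach₂ j
    ... | yes _  | yes _  = ≤-reflexive (+-inverseʳ (Q i j))
    ... | no _   | no _   = ≤-refl
    ... | yes ri | no ¬rj = subst (_≤ 0ℚ) (sym (+-identityʳ (Q i j)))
                              (≮⇒≥ (λ 0<Q → ¬rj (extend-forward ri j 0<Q)))
    ... | no ¬ri | yes rj = subst (_≤ 0ℚ) (sym (+-identityˡ (- Q i j))) (neg-antimono-≤ (≮⇒≥ Q≮0))
      where
      Q≮0 : ¬ Q i j < 0ℚ
      Q≮0 Q<0 with i ∈? A
      ... | yes i∈A = ¬ri (extend-backward rj i i∈A Q<0)
      ... | no  i∉A = <-irrefl refl (<-≤-trans Q<0 (Q-outside i j i∉A))

    net-outflow≡ : net-outflow ≡ sumFin m (λ i → sumFin n (λ j → inside₁ i (Q i j) - inside₂ j (Q i j)))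
    net-outflow≡ = sym (begin
      sumFin m (λ i → sumFin n (λ j → inside₁ i (Q i j) - inside₂ j (Q i j)))
        ≡⟨ sumFin-cong m (λ i → sumFin-- n (λ j → inside₁ i (Q i j)) (λ j → inside₂ j (Q i j))) ⟩
      sumFin m (λ i → sumFin n (λ j → inside₁ i (Q i j)) - sumFin n (λ j → inside₂ j (Q i j)))
        ≡⟨ sumFin-- m _ _ ⟩
      sumFin m (λ i → sumFin n (λ j → inside₁ i (Q i j)))
        - sumFin m (λ i → sumFin n (λ j → inside₂ j (Q i j)))
        ≡⟨ cong₂ _-_ (sumFin-cong m (λ i → sumFin-if n (does (reach₁ i)) (Q i)))
                     (trans (sumFin-comm m n _)
                            (sumFin-cong n (λ j → sumFin-if m (does (reach₂ j)) (λ i → Q i j)))) ⟩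
      net-outflow ∎)
      where open ≡-Reasoning

    net-outflow≤0 : net-outflow ≤ 0ℚ
    net-outflow≤0 = begin
      net-outflow  ≡⟨ net-outflow≡ ⟩
      sumFin m (λ i → sumFin n (λ j → inside₁ i (Q i j) - inside₂ j (Q i j)))
                   ≤⟨ sumFin-mono m (λ i → sumFin-mono n (edge-outflow≤0 i)) ⟩
      sumFin m (λ i → sumFin n (λ j → 0ℚ))
                   ≡⟨ sumFin-zero m (λ i → sumFin-zero n (λ _ → refl)) ⟩
      0ℚ ∎
      where open ≤-Reasoning

    source≤net-outflow : rowSum Q t ≤ net-outflow
    source≤net-outflow = begin
      rowSum Q t                                             ≡⟨ sym source-inside ⟩
      inside₁ t (rowSum Q t)                                 ≤⟨ term≤sumFin m facility-nonneg t ⟩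
      sumFin m (λ i → inside₁ i (rowSum Q i))                ≡⟨ sym (+-identityʳ _) ⟩
      sumFin m (λ i → inside₁ i (rowSum Q i)) + 0ℚ
        ≤⟨ +-monoʳ-≤ (sumFin m (λ i → inside₁ i (rowSum Q i))) (neg-antimono-≤ clients≤0) ⟩
      net-outflow ∎
      where
      open ≤-Reasoning hiding (start)
      source-inside : inside₁ t (rowSum Q t) ≡ rowSum Q t
      source-inside with reach₁ t
      ... | yes _  = refl
      ... | no ¬rt = ⊥-elim (¬rt (start , tt))
      facility-nonneg : ∀ i → 0ℚ ≤ inside₁ i (rowSum Q i)
      facility-nonneg i with reach₁ i
      ... | yes ri = ≮⇒≥ (λ end → no-end (inj₁ i , end , ri))
      ... | no _   = ≤-refl
      client-nonpos : ∀ j → inside₂ j (colSum Q j) ≤ 0ℚ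
      client-nonpos j with reach₂ j
      ... | yes rj = ≮⇒≥ (λ end → no-end (inj₂ j , end , rj))
      ... | no _   = ≤-refl
      clients≤0 : sumFin n (λ j → inside₂ j (colSum Q j)) ≤ 0ℚ
      clients≤0 = ≤-trans (sumFin-mono n client-nonpos) (≤-reflexive (sumFin-zero n (λ _ → refl)))

  reachable-end : (∀ i j → i ∉ A → 0ℚ ≤ Q i j) → 0ℚ < rowSum Q t → ¬ ¬ ReachableEnd
  reachable-end Q-outside 0<src no-end =
    ¬¬-decide-Fin m _ λ reach₁ → ¬¬-decide-Fin n _ λ reach₂ →
      let open Cut Q-outside no-end reach₁ reach₂ in
      <-irrefl refl (<-≤-trans 0<src (≤-trans source≤net-outflow net-outflow≤0))

module _ {m n : ℕ} (A : Subset m) {t : Fin m} (t∈A : t ∈ A) where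

  -- For the Q returned, D − Q is a conformal part of D, supported on A, carrying the whole row of t.
  decompose : ∀ (D : Matrix m n) → (∀ i j → i ∉ A → 0ℚ ≤ D i j) → 0ℚ ≤ rowSum D t →
              ¬ ¬ (Σ[ Q ∈ Matrix m n ] (Q ⊑ D × EqualOutside A Q D × rowSum Q t ≡ 0ℚ))
  decompose D D-outside 0≤src = go (suc (size D)) D ⊑-refl (λ _ _ _ → refl) ℕ.≤-refl
    where
    go : ∀ k Q → Q ⊑ D → EqualOutside A Q D → size Q ℕ.< k →
         ¬ ¬ (Σ[ Q ∈ Matrix m n ] (Q ⊑ D × EqualOutside A Q D × rowSum Q t ≡ 0ℚ))
    go (suc k) Q Q⊑D Q≡D size<k with rowSum Q t ≤? 0ℚ
    ... | yes src≤0 = ¬¬.pure (Q , Q⊑D , Q≡D , ≤-antisym src≤0 (≼-nonneg 0≤src (row Q⊑D t)))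
    ... | no  src≰0 = do
      (e , end , p) ← reachable-end Q-outside 0<src
      let (Q′ , Q′⊑Q , Q′≡Q , smaller) = augment 0<src end p
      go k Q′ (⊑-trans Q′⊑Q Q⊑D) (λ i j i∉A → trans (Q′≡Q i j i∉A) (Q≡D i j i∉A))
              (ℕ.<-≤-trans smaller (ℕ.≤-pred size<k))
      where
      open ¬¬
      open Augmentation A t∈A Q
      0<src : 0ℚ < rowSum Q t
      0<src = ≰⇒> src≰0
      Q-outside : ∀ i j → i ∉ A → 0ℚ ≤ Q i j
      Q-outside i j i∉A = subst (0ℚ ≤_) (sym (Q≡D i j i∉A)) (D-outside i j i∉A)

-- Facility location

x∉p⊖x : ∀ {k} (p : Subset k) x → x ∉ p ⊖ x
x∉p⊖x (inside  ∷ p) zero    ()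
x∉p⊖x (outside ∷ p) zero    ()
x∉p⊖x (_       ∷ p) (suc x) (there x∈p⊖x) = x∉p⊖x p x x∈p⊖x

lookup-⁅⁆ : ∀ {k} (t i : Fin k) →
            (lookup ⁅ t ⁆ i ≡ true × δ t i ≡ 1ℚ) ⊎ (lookup ⁅ t ⁆ i ≡ false × δ t i ≡ 0ℚ)
lookup-⁅⁆ zero    zero    = inj₁ (refl , refl)
lookup-⁅⁆ zero    (suc i) = inj₂ (lookup-replicate i outside , refl)
lookup-⁅⁆ (suc t) zero    = inj₂ (refl , refl)
lookup-⁅⁆ (suc t) (suc i) = lookup-⁅⁆ t i

module FacilityLocation {m n : ℕ} (I : Instance m n) where

  open Instance I

  cs+cp : Assignment I → ℚ
  cs+cp w = cs I w + cp I w

  cost≡cf+cs+cp : ∀ S w → cost I S w ≡ cf I S + cs+cp w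
  cost≡cf+cs+cp S w = +-assoc (cf I S) (cs I w) (cp I w)

  cs-⊕ : ∀ a b → cs I (a ⊕ b) ≡ cs I a + cs I b
  cs-⊕ a b = begin
    sumFin m (λ i → sumFin n (λ j → c i j * (a i j + b i j)))
      ≡⟨ sumFin-cong m (λ i → sumFin-cong n (λ j → *-distribˡ-+ (c i j) (a i j) (b i j))) ⟩
    sumFin m (λ i → sumFin n (λ j → c i j * a i j + c i j * b i j))
      ≡⟨ sumFin-cong m (λ i → sumFin-+ n _ _) ⟩
    sumFin m (λ i → sumFin n (λ j → c i j * a i j) + sumFin n (λ j → c i j * b i j))
      ≡⟨ sumFin-+ m _ _ ⟩
    cs I a + cs I b ∎
    where open ≡-Reasoning

  cp-⊕ : ∀ a b → cp I (a ⊕ b) + sumFin n (λ j → p j * d j) ≡ cp I a + cp I b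
  cp-⊕ a b = begin
    cp I (a ⊕ b) + sumFin n (λ j → p j * d j)
      ≡⟨ sym (sumFin-+ n _ _) ⟩
    sumFin n (λ j → p j * (d j - colSum (a ⊕ b) j) + p j * d j)
      ≡⟨ sumFin-cong n (λ j → cong (λ s → p j * (d j - s) + p j * d j) (sumFin-+ m _ _)) ⟩
    sumFin n (λ j → p j * (d j - (colSum a j + colSum b j)) + p j * d j)
      ≡⟨ sumFin-cong n (λ j → affine (p j) (d j) (colSum a j) (colSum b j)) ⟩
    sumFin n (λ j → p j * (d j - colSum a j) + p j * (d j - colSum b j))
      ≡⟨ sumFin-+ n _ _ ⟩
    cp I a + cp I b ∎
    where
    open ≡-Reasoning
    affine : ∀ p d u v → p * (d - (u + v)) + p * d ≡ p * (d - u) + p * (d - v)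
    affine = solve-∀ ℚ-ring

  cs-cong : ∀ {a b} → (∀ i j → a i j ≡ b i j) → cs I a ≡ cs I b
  cs-cong a≗b = sumFin-cong m (λ i → sumFin-cong n (λ j → cong (c i j *_) (a≗b i j)))

  cp-cong : ∀ {a b} → (∀ i j → a i j ≡ b i j) → cp I a ≡ cp I b
  cp-cong a≗b = sumFin-cong n (λ j → cong (λ s → p j * (d j - s)) (sumFin-cong m (λ i → a≗b i j)))

  cs+cp-exchange : ∀ {y z′ x z} → (∀ i j → y i j + z′ i j ≡ x i j + z i j) →
                   cs+cp y + cs+cp z′ ≡ cs+cp x + cs+cp z
  cs+cp-exchange {y} {z′} {x} {z} y⊕z′≗x⊕z = begin
    cs+cp y + cs+cp z′                          ≡⟨ cs+cp-⊕ y z′ ⟩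
    cs I (y ⊕ z′) + (cp I (y ⊕ z′) + K)
      ≡⟨ cong₂ (λ u v → u + (v + K)) (cs-cong y⊕z′≗x⊕z) (cp-cong y⊕z′≗x⊕z) ⟩
    cs I (x ⊕ z) + (cp I (x ⊕ z) + K)           ≡⟨ sym (cs+cp-⊕ x z) ⟩
    cs+cp x + cs+cp z                           ∎
    where
    open ≡-Reasoning
    K : ℚ
    K = sumFin n (λ j → p j * d j)
    cs+cp-⊕ : ∀ a b → cs+cp a + cs+cp b ≡ cs I (a ⊕ b) + (cp I (a ⊕ b) + K)
    cs+cp-⊕ a b = trans (interchange (cs I a) (cp I a) (cs I b) (cp I b))
                        (sym (cong₂ _+_ (cs-⊕ a b) (cp-⊕ a b)))

  fIf-nonneg : ∀ b {a} → 0ℚ ≤ a → 0ℚ ≤ fIf I b a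
  fIf-nonneg true  0≤a = 0≤a
  fIf-nonneg false 0≤a = ≤-refl

  fIf-∨ : ∀ b b′ {a} → 0ℚ ≤ a → fIf I (b ∨ b′) a ≤ fIf I b a + fIf I b′ a
  fIf-∨ true  true  {a} 0≤a = subst (_≤ a + a) (+-identityʳ a) (+-monoʳ-≤ a 0≤a)
  fIf-∨ true  false {a} 0≤a = ≤-reflexive (sym (+-identityʳ a))
  fIf-∨ false true  {a} 0≤a = ≤-reflexive (sym (+-identityˡ a))
  fIf-∨ false false     0≤a = ≤-refl

  cf-∪ : ∀ P P′ → cf I (P ∪ P′) ≤ cf I P + cf I P′
  cf-∪ P P′ = ≤-trans (sumFin-mono m pointwise) (≤-reflexive (sumFin-+ m _ _))
    where
    pointwise : ∀ i → fIf I (lookup (P ∪ P′) i) (f i) ≤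
                      fIf I (lookup P i) (f i) + fIf I (lookup P′ i) (f i)
    pointwise i rewrite lookup-zipWith _∨_ i P P′ = fIf-∨ (lookup P i) (lookup P′ i) (f-nonneg i)

  cf-⁅⁆ : ∀ t → cf I ⁅ t ⁆ ≡ f t
  cf-⁅⁆ t = trans (sumFin-cong m pointwise) (sumFin-δ m t f)
    where
    pointwise : ∀ i → fIf I (lookup ⁅ t ⁆ i) (f i) ≡ δ t i * f i
    pointwise i with lookup-⁅⁆ t i
    ... | inj₁ (t∈ , δ≡1) rewrite t∈ | δ≡1 = sym (*-identityˡ (f i))
    ... | inj₂ (t∉ , δ≡0) rewrite t∉ | δ≡0 = sym (*-zeroˡ (f i))

  rowSum-outside : ∀ {P z} → Feasible I P z → ∀ {i} → i ∉ P → rowSum z i ≡ 0ℚ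
  rowSum-outside fz {i} i∉P = sumFin-zero n (λ j → Feasible.outside fz i j i∉P)

  U-nonneg : ∀ {P z t} → Feasible I P z → t ∈ P → 0ℚ ≤ U
  U-nonneg {z = z} {t} fz t∈P =
    ≤-trans (sumFin-nonneg n (Feasible.nonneg fz t)) (Feasible.capacity fz t t∈P)

  capacity-everywhere : ∀ {P z} → Feasible I P z → 0ℚ ≤ U → ∀ i → rowSum z i ≤ U
  capacity-everywhere {P} fz 0≤U i with i ∈? P
  ... | yes i∈P = Feasible.capacity fz i i∈P
  ... | no  i∉P = subst (_≤ U) (sym (rowSum-outside fz i∉P)) 0≤U

  interpolate : ∀ {S P T x z E} → Feasible I S x → Feasible I P z → E ⊑ (λ i j → z i j - x i j) →
                (∀ i → rowSum x i ≤ U) → (∀ i → i ∈ T → i ∈ P) →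
                (∀ i j → i ∉ T → x i j + E i j ≡ 0ℚ) → Feasible I T (x ⊕ E)
  interpolate {x = x} {z} {E} fx fz E⊑z-x x-cap T⊆P vanishes = record
    { nonneg   = λ i j → Between-≥ (≼-interpolate (entry E⊑z-x i j))
                                   (Feasible.nonneg fx i j) (Feasible.nonneg fz i j)
    ; outside  = vanishes
    ; capacity = λ i i∈T → subst (_≤ U) (sym (sumFin-+ n (x i) (E i)))
                   (Between-≤ (≼-interpolate (subst (rowSum E i ≼_) (sumFin-- n (z i) (x i)) (row E⊑z-x i)))
                              (x-cap i) (Feasible.capacity fz i (T⊆P i i∈T)))
    ; demand   = λ j → subst (_≤ d j) (sym (sumFin-+ m (λ i → x i j) (λ i → E i j)))
                   (Between-≤ (≼-interpolate (subst (colSum E j ≼_) (sumFin-- m (λ i → z i j) (λ i → x i j))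
                                                    (col E⊑z-x j)))
                              (Feasible.demand fx j) (Feasible.demand fz j))
    }

  module Split {S x P z t} (fx : Feasible I S x) (t∉S : t ∉ S) (fz : Feasible I P z) (t∈P : t ∈ P)
               (S⊆P : ∀ i → i ∈ S → i ∈ P) where

    Exchange : Set
    Exchange = Σ[ y ∈ Assignment I ] Σ[ z′ ∈ Assignment I ]
                 (Feasible I (S ∪ ⁅ t ⁆) y × Feasible I (P ⊖ t) z′ ×
                  (∀ i j → y i j + z′ i j ≡ x i j + z i j))

    t∈A : t ∈ S ∪ ⁅ t ⁆
    t∈A = x∈p∪q⁺ (inj₂ (x∈⁅x⁆ t))

    ∉A⇒∉S : ∀ {i} → i ∉ S ∪ ⁅ t ⁆ → i ∉ S
    ∉A⇒∉S i∉A = i∉A ∘ x∈p∪q⁺ ∘ inj₁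

    A⊆P : ∀ i → i ∈ S ∪ ⁅ t ⁆ → i ∈ P
    A⊆P i i∈A with x∈p∪q⁻ S ⁅ t ⁆ i∈A
    ... | inj₁ i∈S = S⊆P i i∈S
    ... | inj₂ i∈t = subst (_∈ P) (sym (x∈⁅y⁆⇒x≡y t i∈t)) t∈P

    D : Matrix m n
    D i j = z i j - x i j

    D≡z : ∀ {i} j → i ∉ S → D i j ≡ z i j
    D≡z {i} j i∉S = trans (cong (λ u → z i j - u) (Feasible.outside fx i j i∉S)) (+-identityʳ (z i j))

    D-nonneg : ∀ {i} j → i ∉ S → 0ℚ ≤ D i j
    D-nonneg {i} j i∉S = subst (0ℚ ≤_) (sym (D≡z j i∉S)) (Feasible.nonneg fz i j)

    x-cap : ∀ i → rowSum x i ≤ U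
    x-cap = capacity-everywhere fx (U-nonneg fz t∈P)

    module _ {Q : Matrix m n} (Q⊑D : Q ⊑ D) (Q≡D : EqualOutside (S ∪ ⁅ t ⁆) Q D)
             (Q-source≡0 : rowSum Q t ≡ 0ℚ) where

      y-vanishes : ∀ i j → i ∉ S ∪ ⁅ t ⁆ → x i j + (D i j - Q i j) ≡ 0ℚ
      y-vanishes i j i∉A = begin
        x i j + (D i j - Q i j)  ≡⟨ cong₂ (λ u v → u + (D i j - v))
                                          (Feasible.outside fx i j (∉A⇒∉S i∉A)) (Q≡D i j i∉A) ⟩
        0ℚ + (D i j - D i j)     ≡⟨ cong (0ℚ +_) (+-inverseʳ (D i j)) ⟩
        0ℚ                       ∎
        where open ≡-Reasoning

      Q-source : ∀ j → Q t j ≡ 0ℚ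
      Q-source = sumFin≡0⇒term≡0 n (λ j → ≼-nonneg (D-nonneg j t∉S) (entry Q⊑D t j)) Q-source≡0

      z′-vanishes : ∀ i j → i ∉ P ⊖ t → x i j + Q i j ≡ 0ℚ
      z′-vanishes i j i∉P⊖t with i ≟ᶠ t
      ... | yes refl = cong₂ _+_ (Feasible.outside fx t j t∉S) (Q-source j)
      ... | no  i≢t  = begin
        x i j + Q i j  ≡⟨ cong (x i j +_) (trans (Q≡D i j i∉A) (D≡z j i∉S)) ⟩
        x i j + z i j  ≡⟨ cong₂ _+_ (Feasible.outside fx i j i∉S) (Feasible.outside fz i j i∉P) ⟩
        0ℚ             ∎
        where
        open ≡-Reasoning
        i∉P : i ∉ P
        i∉P i∈P = i∉P⊖t (x∈p∧x≢y⇒x∈p-y i∈P i≢t)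
        i∉S : i ∉ S
        i∉S = i∉P ∘ S⊆P i
        i∉A : i ∉ S ∪ ⁅ t ⁆
        i∉A = i∉P ∘ A⊆P i

      exchange : Exchange
      exchange = x ⊕ (λ i j → D i j - Q i j) , x ⊕ Q ,
                 interpolate fx fz (⊑-complement Q⊑D) x-cap A⊆P y-vanishes ,
                 interpolate fx fz Q⊑D x-cap (λ i → p─q⊆p P ⁅ t ⁆) z′-vanishes ,
                 λ i j → x+[[z-x]-q]+[x+q]≡x+z (x i j) (z i j) (Q i j)
        where
        x+[[z-x]-q]+[x+q]≡x+z : ∀ x z q → (x + ((z - x) - q)) + (x + q) ≡ x + z
        x+[[z-x]-q]+[x+q]≡x+z = solve-∀ ℚ-ring

    split : ¬ ¬ Exchange
    split = ¬¬-map (λ (Q , Q⊑D , Q≡D , Q-source≡0) → exchange Q⊑D Q≡D Q-source≡0)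
                   (decompose (S ∪ ⁅ t ⁆) t∈A D (λ i j → D-nonneg j ∘ ∉A⇒∉S)
                              (sumFin-nonneg n (λ j → D-nonneg j t∉S)))

  open Split using (split)

  Feasible-∪ : ∀ {S x S* z} → Feasible I S x → Feasible I S* z → Feasible I (S ∪ S*) z
  Feasible-∪ {S} {x} {S*} {z} fx fz = record
    { nonneg   = Feasible.nonneg fz
    ; outside  = λ i j i∉S∪S* → Feasible.outside fz i j (i∉S∪S* ∘ x∈p∪q⁺ ∘ inj₂)
    ; capacity = capacity
    ; demand   = Feasible.demand fz
    }
    where
    capacity : ∀ i → i ∈ S ∪ S* → rowSum z i ≤ U
    capacity i i∈S∪S* with x∈p∪q⁻ S S* i∈S∪S*
    ... | inj₁ i∈S  = capacity-everywhere fz (U-nonneg fx i∈S) i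
    ... | inj₂ i∈S* = Feasible.capacity fz i i∈S*

  Feasible-⊆ : ∀ {P P′ z} → (∀ i → i ∈ P → i ∈ P′) → (∀ i → i ∈ P′ → i ∈ P) →
               Feasible I P z → Feasible I P′ z
  Feasible-⊆ P⊆P′ P′⊆P fz = record
    { nonneg   = Feasible.nonneg fz
    ; outside  = λ i j i∉P′ → Feasible.outside fz i j (i∉P′ ∘ P⊆P′ i)
    ; capacity = λ i i∈P′ → Feasible.capacity fz i (P′⊆P i i∈P′)
    ; demand   = Feasible.demand fz
    }

  module LocalSearch {S x} (lo : LocallyOptimal I S x) where

    min-bound : ∀ {z} → Feasible I S z → cs+cp x ≤ cs+cp z
    min-bound {z} fz = +-cancelˡ-≤ (cf I S)
      (subst₂ _≤_ (cost≡cf+cs+cp S x) (cost≡cf+cs+cp S z) (LocallyOptimal.minAssign lo z fz))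

    add-bound : ∀ {t y} → t ∉ S → Feasible I (S ∪ ⁅ t ⁆) y → cs+cp x ≤ cs+cp y + f t
    add-bound {t} {y} t∉S fy = +-cancelˡ-≤ (cf I S) (begin
      cf I S + cs+cp x           ≡⟨ sym (cost≡cf+cs+cp S x) ⟩
      cost I S x                 ≤⟨ LocallyOptimal.noImprove lo _ (add t t∉S) y fy ⟩
      cost I (S ∪ ⁅ t ⁆) y       ≡⟨ cost≡cf+cs+cp (S ∪ ⁅ t ⁆) y ⟩
      cf I (S ∪ ⁅ t ⁆) + cs+cp y ≤⟨ +-monoˡ-≤ (cs+cp y) (cf-∪ S ⁅ t ⁆) ⟩
      cf I S + cf I ⁅ t ⁆ + cs+cp y ≡⟨ cong (λ u → cf I S + u + cs+cp y) (cf-⁅⁆ t) ⟩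
      cf I S + f t + cs+cp y     ≡⟨ rearrange (cf I S) (f t) (cs+cp y) ⟩
      cf I S + (cs+cp y + f t)   ∎)
      where
      open ≤-Reasoning
      rearrange : ∀ a b c → a + b + c ≡ a + (c + b)
      rearrange = solve-∀ ℚ-ring

    module _ (S* : Subset m) where

      -- h enumerates candidate facilities, of which only those in S* are charged; for h = id,
      -- openingCost is cf S* by definition.
      Opened : ∀ k → (Fin k → Fin m) → Fin m → Set
      Opened k h i = i ∈ S ⊎ (i ∈ S* × Σ[ a ∈ Fin k ] h a ≡ i)

      openingCost : ∀ k → (Fin k → Fin m) → ℚ
      openingCost k h = sumFin k (λ a → fIf I (lookup S* (h a)) (f (h a)))

      Opened-tail : ∀ {k} h {i} → Opened (suc k) h i → (h zero ≡ i → i ∈ S* → i ∈ S) →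
                    Opened k (h ∘ suc) i
      Opened-tail h (inj₁ i∈S)                  _     = inj₁ i∈S
      Opened-tail h (inj₂ (i∈S* , zero , refl)) first = inj₁ (first refl i∈S*)
      Opened-tail h (inj₂ (i∈S* , suc a , ha≡i)) _    = inj₂ (i∈S* , a , ha≡i)

      Bound : ∀ k → (Fin k → Fin m) → Set
      Bound k h = ∀ {P z} → Feasible I P z → (∀ i → i ∈ S → i ∈ P) →
                  (∀ i → i ∈ P → Opened k h i) → cs+cp x ≤ cs+cp z + openingCost k h

      bound-base : ∀ h → Bound zero h
      bound-base h {P} {z} fz S⊆P P⊆O =
        subst (cs+cp x ≤_) (sym (+-identityʳ (cs+cp z))) (min-bound (Feasible-⊆ P⊆S S⊆P fz))
        where
        P⊆S : ∀ i → i ∈ P → i ∈ S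
        P⊆S i i∈P with P⊆O i i∈P
        ... | inj₁ i∈S = i∈S

      module Step k (h : Fin (suc k) → Fin m) (IH : Bound k (h ∘ suc)) {P z} (fz : Feasible I P z)
                  (S⊆P : ∀ i → i ∈ S → i ∈ P) (P⊆O : ∀ i → i ∈ P → Opened (suc k) h i) where

        t : Fin m
        t = h zero

        opening : t ∉ S → t ∈ S* → t ∈ P → cs+cp x ≤ cs+cp z + openingCost (suc k) h
        opening t∉S t∈S* t∈P =
          decidable-stable (_ ≤? _)
            (¬¬-map via-exchange (split (LocallyOptimal.feasible lo) t∉S fz t∈P S⊆P))
          where
          S⊆P⊖t : ∀ i → i ∈ S → i ∈ P ⊖ t
          S⊆P⊖t i i∈S = x∈p∧x≢y⇒x∈p-y (S⊆P i i∈S) (λ i≡t → t∉S (subst (_∈ S) i≡t i∈S))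
          P⊖t⊆O : ∀ i → i ∈ P ⊖ t → Opened k (h ∘ suc) i
          P⊖t⊆O i i∈P⊖t = Opened-tail h (P⊆O i (p─q⊆p P ⁅ t ⁆ i∈P⊖t))
                            (λ { refl _ → ⊥-elim (x∉p⊖x P t i∈P⊖t) })
          opening-t : fIf I (lookup S* t) (f t) ≡ f t
          opening-t = cong (λ b → fIf I b (f t)) ([]=⇒lookup t∈S*)
          via-exchange : Split.Exchange (LocallyOptimal.feasible lo) t∉S fz t∈P S⊆P →
                         cs+cp x ≤ cs+cp z + openingCost (suc k) h
          via-exchange (y , z′ , fy , fz′ , y+z′≡x+z) =
            subst (λ g → cs+cp x ≤ cs+cp z + (g + openingCost k (h ∘ suc))) (sym opening-t)
                  (split-bound {y = cs+cp y} {cs+cp z′} {a = f t} {openingCost k (h ∘ suc)}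
                               (add-bound t∉S fy) (IH fz′ S⊆P⊖t P⊖t⊆O)
                               (cs+cp-exchange {y} {z′} {x} {z} y+z′≡x+z))

        skipping : ¬ (t ∉ S × t ∈ S* × t ∈ P) → cs+cp x ≤ cs+cp z + openingCost (suc k) h
        skipping ¬opens = ≤-trans (IH fz S⊆P P⊆O′) (+-monoʳ-≤ (cs+cp z) drop-first)
          where
          P⊆O′ : ∀ i → i ∈ P → Opened k (h ∘ suc) i
          P⊆O′ i i∈P = Opened-tail h (P⊆O i i∈P) first
            where
            first : t ≡ i → i ∈ S* → i ∈ S
            first refl i∈S* with i ∈? S
            ... | yes i∈S = i∈S
            ... | no  i∉S = ⊥-elim (¬opens (i∉S , i∈S* , i∈P))
          drop-first : openingCost k (h ∘ suc) ≤ openingCost (suc k) h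
          drop-first = subst (_≤ openingCost (suc k) h) (+-identityˡ (openingCost k (h ∘ suc)))
                             (+-monoˡ-≤ (openingCost k (h ∘ suc)) (fIf-nonneg (lookup S* t) (f-nonneg t)))

      bound-step : ∀ k h → Bound k (h ∘ suc) → Bound (suc k) h
      bound-step k h IH {P} fz S⊆P P⊆O with ¬? (h zero ∈? S) ×-dec (h zero ∈? S*) ×-dec (h zero ∈? P)
      ... | yes (t∉S , t∈S* , t∈P) = Step.opening k h IH fz S⊆P P⊆O t∉S t∈S* t∈P
      ... | no  ¬opens             = Step.skipping k h IH fz S⊆P P⊆O ¬opens

      bound : ∀ k h → Bound k h
      bound zero    h = bound-base h
      bound (suc k) h = bound-step k h (bound k (h ∘ suc))

lemma6 : ∀ {m n} (I : Instance m n) (S S* : Subset m) (x x* : Assignment I)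
       → LocallyOptimal I S x → Optimal I S* x*
       → cs I x + cp I x ≤ cs I x* + cp I x* + cf I S*
lemma6 {m} I S S* x x* lo op =
  bound S* m (λ i → i) (Feasible-∪ (LocallyOptimal.feasible lo) (Optimal.feasible op))
        (λ i → p⊆p∪q S*) opened
  where
  open FacilityLocation I
  open LocalSearch lo
  opened : ∀ i → i ∈ S ∪ S* → Opened S* m (λ i → i) i
  opened i i∈S∪S* with x∈p∪q⁻ S S* i∈S∪S*
  ... | inj₁ i∈S  = inj₁ i∈S
  ... | inj₂ i∈S* = inj₂ (i∈S* , i , refl)
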